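{- Let $P$ be an $R$-labeled poset of rank $n$ with fixed $R$-labeling $\lambda$, and let $\mathcal{M}$ be a maximal chain in $P$. Then \[ \omega\big(\mathsf{u}(\mathcal{M})\big)=\sum_{E\subseteq\{1,\dots,n\}}y^{\#E}\cdot\mathsf{u}(\mathcal{M},E). \]
   Context: A graded poset $P$ of rank $n$ is a finite poset with unique minimum $\hat 0$ (rank $0$) and unique maximum $\hat 1$ (rank $n$) such that ${\sf rank}(X)$ equals the length of every maximal chain from $\hat 0$ to $X$. An $R$-labeling is a map $\lambda$ from cover relations to positive integers such that every interval has a unique maximal chain with weakly increasing labels; $P$ is $R$-labeled if finite, graded and admitting one. Let $\mathbf{a},\mathbf{b}$ be noncommuting variables. For a maximal chain $\mathcal{M}=\{\mathcal{M}_0\lessdot\dots\lessdot\mathcal{M}_n\}$, $\mathsf{u}(\mathcal{M})=u_1\cdots u_n$ with $u_1=\mathbf{a}$ and, for $2\le i\le n$, $u_i=\mathbf{a}$ if $\lambda(\mathcal{M}_{i-2},\mathcal{M}_{i-1})\le\lambda(\mathcal{M}_{i-1},\mathcal{M}_i)$, else $\mathbf{b}$. For $E\subseteq\{1,\dots,n\}$, $\mathsf{u}(\mathcal{M},E)=v_1\cdots v_n$ with $v_i=\mathbf{a}$ if ($u_i=\mathbf{a}$, $i\notin E$) or ($u_i=\mathbf{b}$, $i-1\in E$), and $v_i=\mathbf{b}$ if ($u_i=\mathbf{a}$, $i\in E$) or ($u_i=\mathbf{b}$, $i-1\notin E$). For a monomial in $\mathbf{a},\mathbf{b}$, $\omega$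 replaces all occurrences of $\mathbf{a}\mathbf{b}$ with $\mathbf{a}\mathbf{b}+y\mathbf{b}\mathbf{a}+y\mathbf{a}\mathbf{b}+y^2\mathbf{b}\mathbf{a}$ and then simultaneously replaces all remaining $\mathbf{a}$ with $\mathbf{a}+y\mathbf{b}$ and all remaining $\mathbf{b}$ with $\mathbf{b}+y\mathbf{a}$; it is extended linearly. -}

module Defs where

open import Level using (0ℓ)
open import Data.Nat using (ℕ; zero; suc; _≤_; _≤ᵇ_)
open import Data.Bool using (Bool; true; false; if_then_else_)
open import Data.List using (List; []; _∷_; _++_; length; map; concatMap)
open import Data.Vec using (Vec; toList)
import Data.Vec as Vec
open import Data.Product using (Σ; _×_; _,_; ∃; ∃-syntax)
open import Data.Empty using (⊥)
open import Data.Unit using (⊤)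
open import Relation.Nullary using (¬_)
open import Relation.Binary.PropositionalEquality using (_≡_)
open import Relation.Binary.Structures using (IsPartialOrder)
open import Data.List.Membership.Propositional using (_∈_)
open import Data.Fin.Subset using (Subset; ∣_∣)

record FinitePoset : Set₁ where
  field
    Carrier        : Set
    _≤P_           : Carrier → Carrier → Set
    isPartialOrder : IsPartialOrder _≡_ _≤P_
    elements       : List Carrier
    complete       : ∀ x → x ∈ elements

  _<P_ : Carrier → Carrier → Set
  x <P y = x ≤P y × ¬ (x ≡ y)

  _⋖_ : Carrier → Carrier → Set
  x ⋖ y = x <P y × ¬ (Σ Carrier λ z → x <P z × z <P y)

  -- Saturated x l y : x ⋖ l₁ ⋖ l₂ ⋖ … ⋖ lₖ = y  (the list l lists the
  -- chain elements after x); these are exactly the maximal chains of [x,y].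
  Saturated : Carrier → List Carrier → Carrier → Set
  Saturated x []       y = x ≡ y
  Saturated x (z ∷ zs) y = (x ⋖ z) × Saturated z zs y

open FinitePoset public

record GradedOfRank (P : FinitePoset) (n : ℕ) : Set where
  field
    bot     : Carrier P
    top     : Carrier P
    bot-min : ∀ x → _≤P_ P bot x
    top-max : ∀ x → _≤P_ P x top
    rank    : Carrier P → ℕ
    rank-bot : rank bot ≡ 0
    rank-top : rank top ≡ n
    rank-chains : ∀ X (l : List (Carrier P)) → Saturated P bot l X → length l ≡ rank X

open GradedOfRank public

-- Edge labelings (values at non-covers are irrelevant)

Labeling : FinitePoset → Set
Labeling P = Carrier P → Carrier P → ℕ

chainLabels : (P : FinitePoset) → Labeling P → Carrier P → List (Carrier P) → List ℕ
chainLabels P lab x []       = []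
chainLabels P lab x (z ∷ zs) = lab x z ∷ chainLabels P lab z zs

WeaklyIncreasing : List ℕ → Set
WeaklyIncreasing []           = ⊤
WeaklyIncreasing (x ∷ [])     = ⊤
WeaklyIncreasing (x ∷ y ∷ ys) = x ≤ y × WeaklyIncreasing (y ∷ ys)

IsRLabeling : (P : FinitePoset) → Labeling P → Set
IsRLabeling P lab =
  (∀ x y → _⋖_ P x y → 1 ≤ lab x y) ×
  (∀ x y → _≤P_ P x y →
     Σ (List (Carrier P)) λ l →
       (Saturated P x l y × WeaklyIncreasing (chainLabels P lab x l)) ×
       (∀ l′ → Saturated P x l′ y → WeaklyIncreasing (chainLabels P lab x l′) → l′ ≡ l))

-- A maximal chain M = {M₀ ⋖ M₁ ⋖ … ⋖ Mₙ} of a graded poset: M₀ = 0̂, Mₙ = 1̂.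
-- Represented by the list M₁ … Mₙ.
MaximalChain : (P : FinitePoset) {n : ℕ} → GradedOfRank P n → List (Carrier P) → Set
MaximalChain P G M = Saturated P (bot G) M (top G)

data Letter : Set where
  𝐚 𝐛 : Letter

Word : Set
Word = List Letter

ascents : ℕ → List ℕ → Word
ascents l []       = []
ascents l (m ∷ ms) = (if l ≤ᵇ m then 𝐚 else 𝐛) ∷ ascents m ms

uOfLabels : List ℕ → Word
uOfLabels []       = []
uOfLabels (l ∷ ls) = 𝐚 ∷ ascents l ls

uChain : (P : FinitePoset) {n : ℕ} → GradedOfRank P n → Labeling P → List (Carrier P) → Word
uChain P G lab M = uOfLabels (chainLabels P lab (bot G) M)

-- u(M,E): position i carries uᵢ and the flag (i ∈ E); prev is (i-1 ∈ E),
-- initially false since 0 ∉ E.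
twist : Bool → Word → List Bool → Word
twist prev (𝐚 ∷ us) (e ∷ es) = (if e then 𝐛 else 𝐚) ∷ twist e us es
twist prev (𝐛 ∷ us) (e ∷ es) = (if prev then 𝐚 else 𝐛) ∷ twist e us es
twist prev _        _        = []

uChainE : (P : FinitePoset) {n : ℕ} → GradedOfRank P n → Labeling P →
          List (Carrier P) → Subset n → Word
uChainE P G lab M E = twist false (uChain P G lab M) (toList E)

-- Elements of ℕ[y]⟨a,b⟩ as formal sums: a list of terms (k , w) stands for
-- Σ y^k · w.  Two such sums are equal iff they are permutations of each other.

Poly : Set
Poly = List (ℕ × Word)

_⊗_ : Poly → Poly → Poly
p ⊗ q = concatMap (λ { (i , v) → map (λ { (j , w) → (i Data.Nat.+ j , v ++ w) }) q }) p
  where import Data.Nat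

ω : Word → Poly
ω []           = (0 , []) ∷ []
ω (𝐚 ∷ 𝐛 ∷ w) = ((0 , 𝐚 ∷ 𝐛 ∷ []) ∷ (1 , 𝐛 ∷ 𝐚 ∷ []) ∷ (1 , 𝐚 ∷ 𝐛 ∷ []) ∷ (2 , 𝐛 ∷ 𝐚 ∷ []) ∷ []) ⊗ ω w
ω (𝐚 ∷ w)      = ((0 , 𝐚 ∷ []) ∷ (1 , 𝐛 ∷ []) ∷ []) ⊗ ω w
ω (𝐛 ∷ w)      = ((0 , 𝐛 ∷ []) ∷ (1 , 𝐚 ∷ []) ∷ []) ⊗ ω w

allSubsets : (n : ℕ) → List (Subset n)
allSubsets zero    = Vec.[] ∷ []
allSubsets (suc n) = map (true Vec.∷_) (allSubsets n) ++ map (false Vec.∷_) (allSubsets n)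

rhsSum : (P : FinitePoset) {n : ℕ} → GradedOfRank P n → Labeling P → List (Carrier P) → Poly
rhsSum P {n} G lab M = map (λ E → (∣ E ∣ , uChainE P G lab M E)) (allSubsets n)

{-# OPTIONS --safe #-}
-- twistSum p w is Σ_E y^{#E} · twist p w E, where the flag p says whether
-- the position just before w lies in E.  Splitting off the first position, a
-- 𝐛 only reads the flag of its predecessor, so twistSum p (𝐛 ∷ w) is a single
-- letter times twistSum⁺ w = twistSum false w + y · twistSum true w, while a
-- word not starting with 𝐛 ignores the flag.  A joint induction then gives
-- twistSum⁺ w = (1 + y) ω(w) for every word and twistSum false w = ω(w) for
-- every word starting with 𝐚, using only that 1 + y commutes with letters.
module Submission where

open import Defs
open import Data.Bool using (Bool; true; false; if_then_else_)
open import Data.Fin.Subset using (Subset; ∣_∣)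
open import Data.List using (List; []; _∷_; _++_; map; length)
open import Data.List.Properties
  using (map-++; map-∘; map-cong; map-id; ++-assoc; ++-identityʳ; concatMap-++)
open import Data.List.Relation.Binary.Permutation.Propositional
  using (_↭_; refl; prep; swap; trans; ↭-refl; ↭-sym; ↭-trans; module PermutationReasoning)
open import Data.List.Relation.Binary.Permutation.Propositional.Properties
  using (++⁺; ++⁺ˡ; ++-comm; map⁺; shifts)
open import Data.Nat using (ℕ; zero; suc; _+_)
open import Data.Nat.Properties using (+-assoc; suc-injective)
open import Data.Product using (_×_; _,_)
open import Data.Vec using (toList)
import Data.Vec as Vec
open import Relation.Binary.PropositionalEquality
  using (_≡_; refl; sym; cong; cong₂; module ≡-Reasoning)
import Relation.Binary.PropositionalEquality as Eq

_·_ : ℕ × Word → ℕ × Word → ℕ × Word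
(i , v) · (j , w) = (i + j , v ++ w)

·-assoc : ∀ r s t → (r · s) · t ≡ r · (s · t)
·-assoc (i , u) (j , v) (k , w) = cong₂ _,_ (+-assoc i j k) (++-assoc u v w)

_⊙_ : ℕ × Word → Poly → Poly
t ⊙ p = map (t ·_) p

mono : ℕ → Word → Poly
mono k w = (k , w) ∷ []

𝟏 𝐲 : Poly
𝟏 = mono 0 []
𝐲 = mono 1 []

mono-⊗ : ∀ k w p → mono k w ⊗ p ≡ (k , w) ⊙ p
mono-⊗ k w p = ++-identityʳ ((k , w) ⊙ p)

⊗-identityˡ : ∀ p → 𝟏 ⊗ p ≡ p
⊗-identityˡ p = Eq.trans (mono-⊗ 0 [] p) (Eq.trans (map-cong (λ _ → refl) p) (map-id p))

⊗-distribʳ-++ : ∀ p q r → (p ++ q) ⊗ r ≡ p ⊗ r ++ q ⊗ r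
⊗-distribʳ-++ p q r = concatMap-++ (_⊙ r) p q

⊙-⊗-assoc : ∀ t q r → (t ⊙ q) ⊗ r ≡ t ⊙ (q ⊗ r)
⊙-⊗-assoc t []      r = refl
⊙-⊗-assoc t (s ∷ q) r = begin
  (t · s) ⊙ r ++ (t ⊙ q) ⊗ r       ≡⟨ cong₂ _++_ ⊙-· (⊙-⊗-assoc t q r) ⟩
  t ⊙ (s ⊙ r) ++ t ⊙ (q ⊗ r)       ≡⟨ sym (map-++ (t ·_) (s ⊙ r) (q ⊗ r)) ⟩
  t ⊙ (s ⊙ r ++ q ⊗ r)             ∎
  where
  open ≡-Reasoning
  ⊙-· : (t · s) ⊙ r ≡ t ⊙ (s ⊙ r)
  ⊙-· = Eq.trans (map-cong (·-assoc t s) r) (map-∘ r)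

⊗-assoc : ∀ p q r → (p ⊗ q) ⊗ r ≡ p ⊗ (q ⊗ r)
⊗-assoc []      q r = refl
⊗-assoc (t ∷ p) q r = begin
  (t ⊙ q ++ p ⊗ q) ⊗ r          ≡⟨ ⊗-distribʳ-++ (t ⊙ q) (p ⊗ q) r ⟩
  (t ⊙ q) ⊗ r ++ (p ⊗ q) ⊗ r    ≡⟨ cong₂ _++_ (⊙-⊗-assoc t q r) (⊗-assoc p q r) ⟩
  t ⊙ (q ⊗ r) ++ p ⊗ (q ⊗ r)    ∎
  where open ≡-Reasoning

⊗-distribˡ-++ : ∀ p q r → p ⊗ (q ++ r) ↭ p ⊗ q ++ p ⊗ r
⊗-distribˡ-++ []      q r = ↭-refl
⊗-distribˡ-++ (t ∷ p) q r = begin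
  t ⊙ (q ++ r) ++ p ⊗ (q ++ r)       ≡⟨ cong (_++ p ⊗ (q ++ r)) (map-++ (t ·_) q r) ⟩
  (t ⊙ q ++ t ⊙ r) ++ p ⊗ (q ++ r)   ≡⟨ ++-assoc (t ⊙ q) (t ⊙ r) _ ⟩
  t ⊙ q ++ t ⊙ r ++ p ⊗ (q ++ r)     ↭⟨ ++⁺ˡ (t ⊙ q) (++⁺ˡ (t ⊙ r) (⊗-distribˡ-++ p q r)) ⟩
  t ⊙ q ++ t ⊙ r ++ p ⊗ q ++ p ⊗ r   ↭⟨ ++⁺ˡ (t ⊙ q) (shifts (t ⊙ r) (p ⊗ q)) ⟩
  t ⊙ q ++ p ⊗ q ++ t ⊙ r ++ p ⊗ r   ≡⟨ sym (++-assoc (t ⊙ q) (p ⊗ q) _) ⟩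
  (t ⊙ q ++ p ⊗ q) ++ t ⊙ r ++ p ⊗ r ∎
  where open PermutationReasoning

⊗-congʳ : ∀ p {q q′} → q ↭ q′ → p ⊗ q ↭ p ⊗ q′
⊗-congʳ []      q↭q′ = ↭-refl
⊗-congʳ (t ∷ p) q↭q′ = ++⁺ (map⁺ (t ·_) q↭q′) (⊗-congʳ p q↭q′)

⊗-congˡ : ∀ {p p′} q → p ↭ p′ → p ⊗ q ↭ p′ ⊗ q
⊗-congˡ q refl            = ↭-refl
⊗-congˡ q (prep t p↭p′)   = ++⁺ˡ (t ⊙ q) (⊗-congˡ q p↭p′)
⊗-congˡ q (swap s t p↭p′) =
  ↭-trans (shifts (s ⊙ q) (t ⊙ q)) (++⁺ˡ (t ⊙ q) (++⁺ˡ (s ⊙ q) (⊗-congˡ q p↭p′)))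
⊗-congˡ q (trans p↭p″ p″↭p′) = ↭-trans (⊗-congˡ q p↭p″) (⊗-congˡ q p″↭p′)

twistLetter : Bool → Letter → Bool → Letter
twistLetter _    𝐚 e = if e then 𝐛 else 𝐚
twistLetter prev 𝐛 _ = if prev then 𝐚 else 𝐛

twist-∷ : ∀ prev x w e es → twist prev (x ∷ w) (e ∷ es) ≡ twistLetter prev x e ∷ twist e w es
twist-∷ prev 𝐚 w e es = refl
twist-∷ prev 𝐛 w e es = refl

twistSum : Bool → Word → Poly
twistSum prev []      = 𝟏
twistSum prev (x ∷ w) = mono 1 (twistLetter prev x true ∷ []) ⊗ twistSum true w
                     ++ mono 0 (twistLetter prev x false ∷ []) ⊗ twistSum false w

map-allSubsets-twist : ∀ n prev w → length w ≡ n →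
  map (λ E → ∣ E ∣ , twist prev w (toList E)) (allSubsets n) ≡ twistSum prev w
map-allSubsets-twist zero    prev []      _   = refl
map-allSubsets-twist (suc n) prev (x ∷ w) len = begin
  map f (map (true Vec.∷_) Es ++ map (false Vec.∷_) Es)
    ≡⟨ map-++ f (map (true Vec.∷_) Es) _ ⟩
  map f (map (true Vec.∷_) Es) ++ map f (map (false Vec.∷_) Es)
    ≡⟨ cong₂ _++_ (subsetsWith true 1 (λ _ → refl)) (subsetsWith false 0 (λ _ → refl)) ⟩
  twistSum prev (x ∷ w) ∎
  where
  open ≡-Reasoning
  Es : List (Subset n)
  Es = allSubsets n
  f : Subset (suc n) → ℕ × Word
  f E = ∣ E ∣ , twist prev (x ∷ w) (toList E)
  subsetsWith : ∀ e k → (∀ E → ∣ e Vec.∷ E ∣ ≡ k + ∣ E ∣) →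
    map f (map (e Vec.∷_) Es) ≡ mono k (twistLetter prev x e ∷ []) ⊗ twistSum e w
  subsetsWith e k weight = begin
    map f (map (e Vec.∷_) Es)
      ≡⟨ sym (map-∘ Es) ⟩
    map (λ E → f (e Vec.∷ E)) Es
      ≡⟨ map-cong (λ E → cong₂ _,_ (weight E) (twist-∷ prev x w e (toList E))) Es ⟩
    map (λ E → t · (∣ E ∣ , twist e w (toList E))) Es
      ≡⟨ map-∘ Es ⟩
    t ⊙ map (λ E → ∣ E ∣ , twist e w (toList E)) Es
      ≡⟨ cong (t ⊙_) (map-allSubsets-twist n e w (suc-injective len)) ⟩
    t ⊙ twistSum e w
      ≡⟨ sym (mono-⊗ k (twistLetter prev x e ∷ []) (twistSum e w)) ⟩
    mono k (twistLetter prev x e ∷ []) ⊗ twistSum e w ∎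
    where
    t : ℕ × Word
    t = (k , twistLetter prev x e ∷ [])

twistSum⁺ : Word → Poly
twistSum⁺ w = twistSum false w ++ 𝐲 ⊗ twistSum true w

twistSum-𝐛∷ : ∀ prev w →
  twistSum prev (𝐛 ∷ w) ↭ mono 0 ((if prev then 𝐚 else 𝐛) ∷ []) ⊗ twistSum⁺ w
twistSum-𝐛∷ prev w = begin
  mono 1 (c ∷ []) ⊗ twistSum true w ++ c₀ ⊗ twistSum false w
    ↭⟨ ++-comm (mono 1 (c ∷ []) ⊗ twistSum true w) (c₀ ⊗ twistSum false w) ⟩
  c₀ ⊗ twistSum false w ++ (c₀ ⊗ 𝐲) ⊗ twistSum true w
    ≡⟨ cong (c₀ ⊗ twistSum false w ++_) (⊗-assoc c₀ 𝐲 (twistSum true w)) ⟩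
  c₀ ⊗ twistSum false w ++ c₀ ⊗ (𝐲 ⊗ twistSum true w)
    ↭⟨ ↭-sym (⊗-distribˡ-++ c₀ (twistSum false w) (𝐲 ⊗ twistSum true w)) ⟩
  c₀ ⊗ twistSum⁺ w ∎
  where
  open PermutationReasoning
  c : Letter
  c = if prev then 𝐚 else 𝐛
  c₀ : Poly
  c₀ = mono 0 (c ∷ [])

twistSum-𝐚∷ : ∀ w → twistSum true w ≡ twistSum false w →
  twistSum false (𝐚 ∷ w) ↭ (mono 0 (𝐚 ∷ []) ++ mono 1 (𝐛 ∷ [])) ⊗ twistSum false w
twistSum-𝐚∷ w flag-irrelevant = begin
  mono 1 (𝐛 ∷ []) ⊗ twistSum true w ++ mono 0 (𝐚 ∷ []) ⊗ twistSum false w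
    ≡⟨ cong (λ s → mono 1 (𝐛 ∷ []) ⊗ s ++ mono 0 (𝐚 ∷ []) ⊗ twistSum false w) flag-irrelevant ⟩
  mono 1 (𝐛 ∷ []) ⊗ twistSum false w ++ mono 0 (𝐚 ∷ []) ⊗ twistSum false w
    ↭⟨ ++-comm (mono 1 (𝐛 ∷ []) ⊗ twistSum false w) (mono 0 (𝐚 ∷ []) ⊗ twistSum false w) ⟩
  mono 0 (𝐚 ∷ []) ⊗ twistSum false w ++ mono 1 (𝐛 ∷ []) ⊗ twistSum false w
    ≡⟨ sym (⊗-distribʳ-++ (mono 0 (𝐚 ∷ [])) (mono 1 (𝐛 ∷ [])) (twistSum false w)) ⟩
  (mono 0 (𝐚 ∷ []) ++ mono 1 (𝐛 ∷ [])) ⊗ twistSum false w ∎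
  where open PermutationReasoning

twistSum-ω : ∀ w → twistSum false (𝐚 ∷ w) ↭ ω (𝐚 ∷ w)
twistSum⁺-ω : ∀ w → twistSum⁺ w ↭ (𝟏 ++ 𝐲) ⊗ ω w

twistSum-ω []      = twistSum-𝐚∷ [] refl
twistSum-ω (𝐚 ∷ w) =
  ↭-trans (twistSum-𝐚∷ (𝐚 ∷ w) refl) (⊗-congʳ (mono 0 (𝐚 ∷ []) ++ mono 1 (𝐛 ∷ [])) (twistSum-ω w))
twistSum-ω (𝐛 ∷ w) = begin
  mono 1 (𝐛 ∷ []) ⊗ twistSum true (𝐛 ∷ w) ++ mono 0 (𝐚 ∷ []) ⊗ twistSum false (𝐛 ∷ w)
    ↭⟨ ++⁺ (⊗-congʳ (mono 1 (𝐛 ∷ [])) (twistSum-𝐛∷ true w))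
           (⊗-congʳ (mono 0 (𝐚 ∷ [])) (twistSum-𝐛∷ false w)) ⟩
  mono 1 (𝐛 ∷ []) ⊗ (mono 0 (𝐚 ∷ []) ⊗ U) ++ mono 0 (𝐚 ∷ []) ⊗ (mono 0 (𝐛 ∷ []) ⊗ U)
    ≡⟨ sym (cong₂ _++_ (⊗-assoc (mono 1 (𝐛 ∷ [])) (mono 0 (𝐚 ∷ [])) U)
                       (⊗-assoc (mono 0 (𝐚 ∷ [])) (mono 0 (𝐛 ∷ [])) U)) ⟩
  mono 1 (𝐛 ∷ 𝐚 ∷ []) ⊗ U ++ mono 0 (𝐚 ∷ 𝐛 ∷ []) ⊗ U
    ↭⟨ ++-comm (mono 1 (𝐛 ∷ 𝐚 ∷ []) ⊗ U) (mono 0 (𝐚 ∷ 𝐛 ∷ []) ⊗ U) ⟩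
  mono 0 (𝐚 ∷ 𝐛 ∷ []) ⊗ U ++ mono 1 (𝐛 ∷ 𝐚 ∷ []) ⊗ U
    ≡⟨ sym (⊗-distribʳ-++ (mono 0 (𝐚 ∷ 𝐛 ∷ [])) (mono 1 (𝐛 ∷ 𝐚 ∷ [])) U) ⟩
  ab+yba ⊗ U
    ↭⟨ ⊗-congʳ ab+yba (twistSum⁺-ω w) ⟩
  ab+yba ⊗ ((𝟏 ++ 𝐲) ⊗ ω w)
    ≡⟨ sym (⊗-assoc ab+yba (𝟏 ++ 𝐲) (ω w)) ⟩
  (ab+yba ⊗ (𝟏 ++ 𝐲)) ⊗ ω w
    ↭⟨ ⊗-congˡ (ω w) expand ⟩
  ω (𝐚 ∷ 𝐛 ∷ w) ∎
  where
  open PermutationReasoning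
  U : Poly
  U = twistSum⁺ w
  ab+yba : Poly
  ab+yba = mono 0 (𝐚 ∷ 𝐛 ∷ []) ++ mono 1 (𝐛 ∷ 𝐚 ∷ [])
  expand : ab+yba ⊗ (𝟏 ++ 𝐲) ↭
    mono 0 (𝐚 ∷ 𝐛 ∷ []) ++ mono 1 (𝐛 ∷ 𝐚 ∷ []) ++ mono 1 (𝐚 ∷ 𝐛 ∷ []) ++ mono 2 (𝐛 ∷ 𝐚 ∷ [])
  expand = prep _ (swap _ _ refl)

twistSum⁺-ω []      = ↭-refl
twistSum⁺-ω (𝐚 ∷ w) = begin
  twistSum false (𝐚 ∷ w) ++ 𝐲 ⊗ twistSum false (𝐚 ∷ w)
    ≡⟨ cong (_++ 𝐲 ⊗ twistSum false (𝐚 ∷ w)) (sym (⊗-identityˡ (twistSum false (𝐚 ∷ w)))) ⟩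
  𝟏 ⊗ twistSum false (𝐚 ∷ w) ++ 𝐲 ⊗ twistSum false (𝐚 ∷ w)
    ≡⟨ sym (⊗-distribʳ-++ 𝟏 𝐲 (twistSum false (𝐚 ∷ w))) ⟩
  (𝟏 ++ 𝐲) ⊗ twistSum false (𝐚 ∷ w)
    ↭⟨ ⊗-congʳ (𝟏 ++ 𝐲) (twistSum-ω w) ⟩
  (𝟏 ++ 𝐲) ⊗ ω (𝐚 ∷ w) ∎
  where open PermutationReasoning
twistSum⁺-ω (𝐛 ∷ w) = begin
  twistSum false (𝐛 ∷ w) ++ 𝐲 ⊗ twistSum true (𝐛 ∷ w)
    ↭⟨ ++⁺ (twistSum-𝐛∷ false w) (⊗-congʳ 𝐲 (twistSum-𝐛∷ true w)) ⟩
  mono 0 (𝐛 ∷ []) ⊗ U ++ 𝐲 ⊗ (mono 0 (𝐚 ∷ []) ⊗ U)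
    ≡⟨ cong (mono 0 (𝐛 ∷ []) ⊗ U ++_) (sym (⊗-assoc 𝐲 (mono 0 (𝐚 ∷ [])) U)) ⟩
  mono 0 (𝐛 ∷ []) ⊗ U ++ mono 1 (𝐚 ∷ []) ⊗ U
    ≡⟨ sym (⊗-distribʳ-++ (mono 0 (𝐛 ∷ [])) (mono 1 (𝐚 ∷ [])) U) ⟩
  b+ya ⊗ U
    ↭⟨ ⊗-congʳ b+ya (twistSum⁺-ω w) ⟩
  b+ya ⊗ ((𝟏 ++ 𝐲) ⊗ ω w)
    ≡⟨ sym (⊗-assoc b+ya (𝟏 ++ 𝐲) (ω w)) ⟩
  (b+ya ⊗ (𝟏 ++ 𝐲)) ⊗ ω w
    ↭⟨ ⊗-congˡ (ω w) commute ⟩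
  ((𝟏 ++ 𝐲) ⊗ b+ya) ⊗ ω w
    ≡⟨ ⊗-assoc (𝟏 ++ 𝐲) b+ya (ω w) ⟩
  (𝟏 ++ 𝐲) ⊗ ω (𝐛 ∷ w) ∎
  where
  open PermutationReasoning
  U : Poly
  U = twistSum⁺ w
  b+ya : Poly
  b+ya = mono 0 (𝐛 ∷ []) ++ mono 1 (𝐚 ∷ [])
  commute : b+ya ⊗ (𝟏 ++ 𝐲) ↭ (𝟏 ++ 𝐲) ⊗ b+ya
  commute = prep _ (swap _ _ refl)

twistSum-uOfLabels : ∀ ls → twistSum false (uOfLabels ls) ↭ ω (uOfLabels ls)
twistSum-uOfLabels []       = ↭-refl
twistSum-uOfLabels (l ∷ ls) = twistSum-ω (ascents l ls)

length-ascents : ∀ l ms → length (ascents l ms) ≡ length ms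
length-ascents l []       = refl
length-ascents l (m ∷ ms) = cong suc (length-ascents m ms)

length-uOfLabels : ∀ ls → length (uOfLabels ls) ≡ length ls
length-uOfLabels []       = refl
length-uOfLabels (l ∷ ls) = cong suc (length-ascents l ls)

length-chainLabels : ∀ P lab x zs → length (chainLabels P lab x zs) ≡ length zs
length-chainLabels P lab x []       = refl
length-chainLabels P lab x (z ∷ zs) = cong suc (length-chainLabels P lab z zs)

length-uChain : ∀ P {n} (G : GradedOfRank P n) lab M → MaximalChain P G M →
  length (uChain P G lab M) ≡ n
length-uChain P {n} G lab M maximal = begin
  length (uOfLabels labels) ≡⟨ length-uOfLabels labels ⟩
  length labels             ≡⟨ length-chainLabels P lab (bot G) M ⟩
  length M                  ≡⟨ rank-chains G (top G) M maximal ⟩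
  rank G (top G)            ≡⟨ rank-top G ⟩
  n                         ∎
  where
  open ≡-Reasoning
  labels : List ℕ
  labels = chainLabels P lab (bot G) M

proposition4p1 : (P : FinitePoset) (n : ℕ) (G : GradedOfRank P n) (lab : Labeling P) →
    IsRLabeling P lab →
    (M : List (Carrier P)) → MaximalChain P G M →
    ω (uChain P G lab M) ↭ rhsSum P G lab M
proposition4p1 P n G lab _ M maximal = begin
  ω (uChain P G lab M)
    ↭⟨ ↭-sym (twistSum-uOfLabels (chainLabels P lab (bot G) M)) ⟩
  twistSum false (uChain P G lab M)
    ≡⟨ sym (map-allSubsets-twist n false (uChain P G lab M) (length-uChain P G lab M maximal)) ⟩
  rhsSum P G lab M ∎
  where open PermutationReasoning
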